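{- For all integers $s,t\ge 2$, the quartet set $Q_{s,t}$ is compatible if and only if $Q_{t,s}$ is compatible.
   Context: For integers $s,t\ge2$, let $\mathcal{L}_{s,t}=\{a_1,\dots,a_s,b_1,\dots,b_t\}$ and $Q_{s,t}=\{a_1b_1|a_sb_t\}\cup\{a_ia_{i+1}|b_jb_{j+1} : 1\le i\le s-1,\ 1\le j\le t-1\}$, a set of quartets on $\mathcal{L}_{s,t}$ (in $Q_{t,s}$ the roles are $a_1,\dots,a_t,b_1,\dots,b_s$). A quartet is a binary unrooted phylogenetic tree with four leaves; $ab|cd$ denotes the quartet on $\{a,b,c,d\}$ in which the path between $a$ and $b$ is disjoint from the path between $c$ and $d$. An unrooted phylogenetic tree is a tree with no degree-two vertex whose leaves are bijectively labeled. A tree $T$ displays a tree $T'$ if $T'$ is obtained from the restriction $T|\mathcal{L}(T')$ (minimal subtree spanning the leaves labeled by $\mathcal{L}(T')$, with degree-two vertices suppressed) by contracting edges. A set of quartets is compatible if some unrooted phylogenetic tree displays all of them. -}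

module Defs where

open import Data.Nat using (ℕ; zero; suc; _≤_)
open import Data.Bool using (Bool; true; false; if_then_else_)
open import Data.Fin using (Fin; toℕ)
open import Data.Sum using (_⊎_; inj₁; inj₂)
open import Data.Product using (Σ; ∃; _×_; _,_)
open import Data.List using (List; []; _∷_; length; map; allFin)
open import Data.Nat.ListAction using (sum)
open import Data.List.Membership.Propositional using (_∈_; _∉_)
open import Data.List.Relation.Unary.Unique.Propositional using (Unique)
open import Data.Empty using (⊥)
open import Relation.Nullary using (¬_)
open import Relation.Binary.PropositionalEquality using (_≡_)

module _ {n : ℕ} (adj : Fin n → Fin n → Bool) where

  data Walk : Fin n → Fin n → Set where
    stop : (u : Fin n) → Walk u u
    step : (u : Fin n) {w v : Fin n} → adj u w ≡ true → Walk w v → Walk u v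

  vertices : {u v : Fin n} → Walk u v → List (Fin n)
  vertices (stop u)       = u ∷ []
  vertices (step u _ p)   = u ∷ vertices p

  IsPath : {u v : Fin n} → Walk u v → Set
  IsPath p = Unique (vertices p)

  degree : Fin n → ℕ
  degree v = sum (map (λ w → if adj v w then 1 else 0) (allFin n))

record PhyloTree (X : Set) : Set where
  field
    n        : ℕ
    adj      : Fin n → Fin n → Bool
    adj-sym  : ∀ u v → adj u v ≡ adj v u
    adj-irr  : ∀ u → adj u u ≡ false
    connected : ∀ u v → Walk adj u v
    acyclic  : ∀ u w (e : adj u w ≡ true) (p : Walk adj w u) →
               IsPath adj p → 3 ≤ length (vertices adj p) → ⊥
    noDeg2   : ∀ v → ¬ (degree adj v ≡ 2)
    label     : X → Fin n
    label-inj : ∀ x y → label x ≡ label y → x ≡ y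
    label-onto : ∀ v → degree adj v ≡ 1 → Σ X (λ x → label x ≡ v)
    label-leaf : ∀ x → degree adj (label x) ≡ 1

record Quartet (X : Set) : Set where
  constructor _,_∣_,_
  field
    qa qb qc qd : X

Displays : {X : Set} → PhyloTree X → Quartet X → Set
Displays T (a , b ∣ c , d) =
  Σ (Walk adj (label a) (label b)) λ p →
  Σ (Walk adj (label c) (label d)) λ q →
  IsPath adj p × IsPath adj q ×
  (∀ v → v ∈ vertices adj p → v ∉ vertices adj q)
  where open PhyloTree T

Compatible : {X : Set} → (Quartet X → Set) → Set
Compatible {X} Q = Σ (PhyloTree X) λ T → ∀ q → Q q → Displays T q

-- The label set L_{s,t} = {a_1..a_s} ∪ {b_1..b_t}: a_i = inj₁ (i-1),
-- b_j = inj₂ (j-1).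

L : ℕ → ℕ → Set
L s t = Fin s ⊎ Fin t

data Q : (s t : ℕ) → Quartet (L s t) → Set where
  ends : ∀ {s t} (a₁ aₛ : Fin s) (b₁ bₜ : Fin t) →
         toℕ a₁ ≡ 0 → suc (toℕ aₛ) ≡ s →
         toℕ b₁ ≡ 0 → suc (toℕ bₜ) ≡ t →
         Q s t (inj₁ a₁ , inj₂ b₁ ∣ inj₁ aₛ , inj₂ bₜ)
  consec : ∀ {s t} (i i' : Fin s) (j j' : Fin t) →
           toℕ i' ≡ suc (toℕ i) → toℕ j' ≡ suc (toℕ j) →
           Q s t (inj₁ i , inj₁ i' ∣ inj₂ j , inj₂ j')

{-# OPTIONS --safe #-}
-- Exchanging the two blocks of labels a and b maps Q_{t,s} onto Q_{s,t}
-- up to the symmetries ab|cd = cd|ab = ba|dc of a quartet, and every tree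
-- displays a quartet together with its symmetric forms.  Relabelling a
-- tree along the exchange therefore transports compatibility.
module Submission where

open import Defs
open import Data.Nat using (ℕ; _≤_)
open import Data.Bool using (Bool; true)
open import Data.Fin using (Fin)
open import Data.Sum using (swap)
open import Data.Sum.Properties using (swap-↔)
open import Data.Product using (_,_)
open import Data.List using (List; _∷_; _++_; [_]; reverse)
open import Data.List.Properties using (unfold-reverse)
open import Data.List.Membership.Propositional using (_∈_)
open import Data.List.Relation.Unary.Any.Properties using (reverse⁻)
open import Data.List.Relation.Unary.Unique.Propositional using (Unique)
open import Data.List.Relation.Binary.Permutation.Propositional.Properties using (↭-reverse)
open import Data.List.Relation.Binary.Permutation.Propositional using (↭-sym; ↭⇒↭ₛ)
open import Function.Bundles using (_↔_; Inverse; _⇔_; mk⇔)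
open import Relation.Binary.PropositionalEquality
  using (_≡_; refl; sym; trans; cong; subst; setoid; module ≡-Reasoning)

module _ {n : ℕ} (adj : Fin n → Fin n → Bool) where

  snocWalk : ∀ {u v w} → Walk adj u v → adj v w ≡ true → Walk adj u w
  snocWalk (stop u)     e = step u e (stop _)
  snocWalk (step u f p) e = step u f (snocWalk p e)

  vertices-snocWalk : ∀ {u v w} (p : Walk adj u v) (e : adj v w ≡ true) →
                      vertices adj (snocWalk p e) ≡ vertices adj p ++ [ w ]
  vertices-snocWalk (stop u)     e = refl
  vertices-snocWalk (step u f p) e = cong (u ∷_) (vertices-snocWalk p e)

  module _ (adj-sym : ∀ u v → adj u v ≡ adj v u) where

    reverseWalk : ∀ {u v} → Walk adj u v → Walk adj v u
    reverseWalk (stop u)         = stop u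
    reverseWalk (step u {w} e p) = snocWalk (reverseWalk p) (trans (adj-sym w u) e)

    vertices-reverseWalk : ∀ {u v} (p : Walk adj u v) →
                           vertices adj (reverseWalk p) ≡ reverse (vertices adj p)
    vertices-reverseWalk (stop u)         = refl
    vertices-reverseWalk (step u {w} e p) = begin
      vertices adj (snocWalk (reverseWalk p) e′)  ≡⟨ vertices-snocWalk (reverseWalk p) e′ ⟩
      vertices adj (reverseWalk p) ++ [ u ]       ≡⟨ cong (_++ [ u ]) (vertices-reverseWalk p) ⟩
      reverse (vertices adj p) ++ [ u ]           ≡⟨ unfold-reverse u (vertices adj p) ⟨
      reverse (u ∷ vertices adj p)                ∎
      where
      open ≡-Reasoning
      e′ : adj w u ≡ true
      e′ = trans (adj-sym w u) e

Unique-reverse : ∀ {A : Set} {xs : List A} → Unique xs → Unique (reverse xs)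
Unique-reverse {A} {xs} = Unique-resp-↭ (↭⇒↭ₛ (↭-sym (↭-reverse xs)))
  where open import Data.List.Relation.Binary.Permutation.Setoid.Properties (setoid A)
          using (Unique-resp-↭)

module _ {X : Set} (T : PhyloTree X) where
  open PhyloTree T

  displays-swap : ∀ {a b c d} → Displays T (a , b ∣ c , d) → Displays T (c , d ∣ a , b)
  displays-swap (p , q , p-path , q-path , disjoint) =
    q , p , q-path , p-path , λ v v∈q v∈p → disjoint v v∈p v∈q

  displays-reverse : ∀ {a b c d} → Displays T (a , b ∣ c , d) → Displays T (b , a ∣ d , c)
  displays-reverse (p , q , p-path , q-path , disjoint) =
    reverseWalk adj adj-sym p , reverseWalk adj adj-sym q ,
    reversePath p p-path , reversePath q q-path ,
    λ v v∈p′ v∈q′ → disjoint v (∈-reversed p v∈p′) (∈-reversed q v∈q′)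
    where
    reversePath : ∀ {u w} (r : Walk adj u w) → IsPath adj r → IsPath adj (reverseWalk adj adj-sym r)
    reversePath r r-path =
      subst Unique (sym (vertices-reverseWalk adj adj-sym r)) (Unique-reverse r-path)

    ∈-reversed : ∀ {u w v} (r : Walk adj u w) →
                 v ∈ vertices adj (reverseWalk adj adj-sym r) → v ∈ vertices adj r
    ∈-reversed r v∈r′ = reverse⁻ (subst (_ ∈_) (vertices-reverseWalk adj adj-sym r) v∈r′)

relabel : {X Y : Set} → X ↔ Y → PhyloTree Y → PhyloTree X
relabel e T = record
  { n          = n
  ; adj        = adj
  ; adj-sym    = adj-sym
  ; adj-irr    = adj-irr
  ; connected  = connected
  ; acyclic    = acyclic
  ; noDeg2     = noDeg2
  ; label      = λ x → label (to x)
  ; label-inj  = λ x y eq → trans (sym (strictlyInverseʳ x))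
                              (trans (cong from (label-inj _ _ eq)) (strictlyInverseʳ y))
  ; label-onto = λ v leaf → let (y , eq) = label-onto v leaf in
                            from y , trans (cong label (strictlyInverseˡ y)) eq
  ; label-leaf = λ x → label-leaf (to x)
  }
  where
  open PhyloTree T
  open Inverse e

mapQuartet : {X Y : Set} → (X → Y) → Quartet X → Quartet Y
mapQuartet f (a , b ∣ c , d) = f a , f b ∣ f c , f d

displays-Q-swap : ∀ {s t} (T : PhyloTree (L s t)) → (∀ q → Q s t q → Displays T q) →
                  ∀ q → Q t s q → Displays T (mapQuartet swap q)
displays-Q-swap T displaysQ _ (ends a₁ aₜ b₁ bₛ a₁≡0 aₜ≡t b₁≡0 bₛ≡s) =
  displays-reverse T (displaysQ _ (ends b₁ bₛ a₁ aₜ b₁≡0 bₛ≡s a₁≡0 aₜ≡t))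
displays-Q-swap T displaysQ _ (consec i i′ j j′ i′≡1+i j′≡1+j) =
  displays-swap T (displaysQ _ (consec j j′ i i′ j′≡1+j i′≡1+i))

-- Displays (relabel e T) q unfolds to Displays T (mapQuartet (Inverse.to e) q).
compatible-Q-swap : ∀ s t → Compatible (Q s t) → Compatible (Q t s)
compatible-Q-swap s t (T , displaysQ) = relabel swap-↔ T , displays-Q-swap T displaysQ

lemma2 : (s t : ℕ) → 2 ≤ s → 2 ≤ t → Compatible (Q s t) ⇔ Compatible (Q t s)
lemma2 s t _ _ = mk⇔ (compatible-Q-swap s t) (compatible-Q-swap t s)
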